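{- Let $n\ge2$, $m\ge2$, and let $M_1$ be the $n\times n$ $0/1$ matrix with $(M_1)_{1,n-1}=(M_1)_{1,n}=1$, $(M_1)_{i+1,i}=1$ for $i=1,\dots,n-1$, and all other entries $0$. Let $\mathbb{A}_0=(a_{i_1\cdots i_m})$ be the nonnegative tensor of order $m$ and dimension $n$ with $a_{ii_2\cdots i_m}=0$ unless $i_2=\cdots=i_m$, and $a_{ij\cdots j}=(M_1)_{ij}$ for all $i,j\in[n]$ (so $M(\mathbb{A}_0)=M_1$). Then $\gamma_{n-1}(\mathbb{A}_0)=n^2-3n+3$.
   Context: For a dimension-$n$ tensor $\mathbb{A}$ of order $m\ge2$ and a dimension-$n$ tensor $\mathbb{B}$ of order $p\ge1$, the product $\mathbb{A}\mathbb{B}$ is the dimension-$n$ tensor $\mathbb{D}$ of order $(m-1)(p-1)+1$ with $d_{i\alpha_1\cdots\alpha_{m-1}}=\sum_{i_2,\dots,i_m=1}^n a_{ii_2\cdots i_m}b_{i_2\alpha_1}\cdots b_{i_m\alpha_{m-1}}$ ($i\in[n]$, $\alpha_t\in[n]^{p-1}$). Powers: $\mathbb{A}^1=\mathbb{A}$, $\mathbb{A}^{k+1}=\mathbb{A}\mathbb{A}^k$. The majorization matrix $M(\mathbb{B})$ of a dimension-$n$ tensor $\mathbb{B}$ of order $\ge2$ is the $n\times n$ matrix with $(M(\mathbb{B}))_{ij}=b_{ij\cdots j}$. A nonnegative tensor $\mathbb{A}$ is $j$-primitive if there is a positive integer $k$ with $(M(\mathbb{A}^k))_{uj}>0$ for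 all $u\in[n]$; the least such $k$ is the $j$-primitive degree $\gamma_j(\mathbb{A})$. -}

module Defs where

open import Data.Nat using (ℕ; zero; suc; _+_; _*_; _∸_; _≤_; _<_; _≡ᵇ_)
open import Data.Bool using (Bool; true; false; if_then_else_; _∧_; _∨_)
open import Data.Fin using (Fin; toℕ; combine) renaming (zero to fzero; suc to fsuc)
open import Data.List using (List; map; allFin)
open import Data.Nat.ListAction using (sum; product)
open import Data.Bool.ListAction using (all)
open import Data.Product using (_×_)
open import Relation.Nullary using (¬_)

-- A dimension-n tensor of order q+1 with nonnegative (natural-number) entries:
-- entries t i ι where i is the first index and ι : Fin q → Fin n are the
-- remaining q indices.  (Indices are 0-based: Fin n = {0,…,n-1} ↔ [n].)
Tensor : ℕ → ℕ → Set
Tensor n q = Fin n → (Fin q → Fin n) → ℕ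

Σfin : (n : ℕ) → (Fin n → ℕ) → ℕ
Σfin n f = sum (map f (allFin n))

Πfin : (n : ℕ) → (Fin n → ℕ) → ℕ
Πfin n f = product (map f (allFin n))

_∷ᶠ_ : ∀ {n k} → Fin n → (Fin k → Fin n) → Fin (suc k) → Fin n
(x ∷ᶠ g) fzero = x
(x ∷ᶠ g) (fsuc t) = g t

Σidx : (n k : ℕ) → ((Fin k → Fin n) → ℕ) → ℕ
Σidx n zero f = f (λ ())
Σidx n (suc k) f = Σfin n (λ x → Σidx n k (λ g → f (x ∷ᶠ g)))

-- Tensor product: A of order r+1, B of order s+1 gives D = A B of order r*s+1,
-- d_{i α_1 ⋯ α_r} = Σ_{i_2..i_{r+1}} a_{i i_2 ⋯} b_{i_2 α_1} ⋯ b_{i_{r+1} α_r},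
-- where the tail index of D (length r*s) is split into r blocks α_t of length s
-- via combine t u (block t, position u).
_⊙_ : ∀ {n r s} → Tensor n r → Tensor n s → Tensor n (r * s)
_⊙_ {n} {r} {s} A B i α =
  Σidx n r (λ ι → A i ι * Πfin r (λ t → B (ι t) (λ u → α (combine t u))))

-- tail length of A^(k+1) when A has tail length r
powTail : ℕ → ℕ → ℕ
powTail r zero = r
powTail r (suc k) = r * powTail r k

-- pow A k = A^(k+1):  A^1 = A,  A^(k+2) = A A^(k+1)
pow : ∀ {n r} → Tensor n r → (k : ℕ) → Tensor n (powTail r k)
pow A zero = A
pow A (suc k) = A ⊙ pow A k

-- A^k for k ≥ 1 (k = 0 is never used below; it is mapped to A^1 harmlessly
-- but every use is guarded by 1 ≤ k)
_^ᵗ_ : ∀ {n r} → Tensor n r → (k : ℕ) → Tensor n (powTail r (k ∸ 1))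
A ^ᵗ k = pow A (k ∸ 1)

Mj : ∀ {n q} → Tensor n q → Fin n → Fin n → ℕ
Mj B i j = B i (λ _ → j)

ColPos : ∀ {n r} → Tensor n r → Fin n → ℕ → Set
ColPos {n} A j k = (u : Fin n) → 0 < Mj (A ^ᵗ k) u j

IsPrimitiveDegree : ∀ {n r} → Tensor n r → Fin n → ℕ → Set
IsPrimitiveDegree A j k =
  (1 ≤ k) × ColPos A j k × ((k' : ℕ) → 1 ≤ k' → k' < k → ¬ ColPos A j k')

-- The matrix M₁ (0-based): entries (0,n-2),(0,n-1) and (i+1,i) are 1, else 0.
M₁ : (n : ℕ) → Fin n → Fin n → ℕ
M₁ n i j =
  if ((toℕ i ≡ᵇ 0) ∧ ((toℕ j ≡ᵇ n ∸ 2) ∨ (toℕ j ≡ᵇ n ∸ 1)))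
     ∨ (toℕ i ≡ᵇ suc (toℕ j))
  then 1 else 0

allEq : ∀ {n q} → (Fin q → Fin n) → Fin n → ℕ
allEq {n} {q} ι j = if all (λ t → toℕ (ι t) ≡ᵇ toℕ j) (allFin q) then 1 else 0

𝔸₀ : (n r : ℕ) → Tensor n r
𝔸₀ n r i ι = Σfin n (λ j → M₁ n i j * allEq ι j)

module Submission where

-- Proof idea.  𝔸₀ is the diagonal tensor of M₁: entry M₁ i v at (i, v, …, v)
-- and 0 elsewhere.  For the diagonal tensor D of a matrix M, M(D^(k+1))_{uw} > 0
-- iff the digraph of M has a walk of length k+1 from u to w.  If that digraph
-- has no sinks, walks to j can be lengthened, so γ_j(D) = k+1 as soon as all
-- vertices have walks of length k+1 to j and some vertex has none of length k.
--
-- For n = p+2 the digraph of M₁ has the arcs 0 → p, 0 → p+1 and y+1 → y: two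
-- cycles of lengths p+1 and p+2 through 0 and p.  With labels as potentials, a
-- walk of length L from x to y satisfies L + y = x + a(p+1) + b(p+2); since
-- s²-s-1 is no combination of s and s+1 (Frobenius), no walk of length p(p+1)
-- leads from p+1 to p.  Explicit walks of length p(p+1)+1 = n²-3n+3 from every
-- vertex to p = n-2 give the upper bound.

open import Defs
open import Data.Nat using (ℕ; _+_; _*_; _∸_; _≤_)
open import Data.Fin using (Fin; toℕ)
open import Relation.Binary.PropositionalEquality using (_≡_)

open import Data.Nat using (zero; suc; _<_; z≤n; s≤s; s≤s⁻¹; z<s; _≡ᵇ_; _≤?_)
open import Data.Nat.Properties
open import Data.Nat.ListAction using (sum; product)
open import Data.Nat.Tactic.RingSolver using (solve-∀)
open import Data.Fin using (fromℕ; inject₁) renaming (zero to fzero; suc to fsuc)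
open import Data.Fin.Properties using (toℕ-injective; toℕ<n; toℕ-fromℕ; toℕ-inject₁)
open import Data.List using ([]; _∷_; map; allFin)
open import Data.List.Membership.Propositional using (_∈_)
open import Data.List.Membership.Propositional.Properties using (∈-allFin)
open import Data.List.Relation.Unary.Any using (here; there)
import Data.List.Relation.Unary.All as All
open import Data.List.Relation.Unary.All.Properties using (all⁺; all⁻)
open import Data.Bool using (Bool; true; T; if_then_else_; _∧_; _∨_)
open import Data.Bool.Properties using (T-∧; T-∨)
open import Data.Product using (Σ; _×_; _,_; proj₁; proj₂)
open import Data.Sum using (_⊎_; inj₁; inj₂)
open import Data.Empty using (⊥; ⊥-elim)
open import Function.Bundles using (_⇔_; mk⇔; Equivalence)
open import Relation.Nullary using (¬_; Dec; yes; no)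
open import Relation.Binary.PropositionalEquality
  using (_≢_; refl; sym; trans; cong; subst; subst₂; module ≡-Reasoning)

open Equivalence using (to; from)

+-pos⁻ : ∀ a b → 0 < a + b → 0 < a ⊎ 0 < b
+-pos⁻ zero    b h = inj₂ h
+-pos⁻ (suc a) b _ = inj₁ z<s

*-pos⁺ : ∀ {a b} → 0 < a → 0 < b → 0 < a * b
*-pos⁺ {suc a} {suc b} _ _ = z<s

*-pos⁻ : ∀ a b → 0 < a * b → 0 < a × 0 < b
*-pos⁻ (suc a) (suc b) _ = z<s , z<s
*-pos⁻ (suc a) zero    h = ⊥-elim (<-irrefl (sym (*-zeroʳ (suc a))) h)

sum-pos⁻ : ∀ {A : Set} (f : A → ℕ) xs → 0 < sum (map f xs) → Σ A (λ x → 0 < f x)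
sum-pos⁻ f (x ∷ xs) h with +-pos⁻ (f x) (sum (map f xs)) h
... | inj₁ fx>0 = x , fx>0
... | inj₂ rest = sum-pos⁻ f xs rest

sum-pos⁺ : ∀ {A : Set} (f : A → ℕ) {xs x} → x ∈ xs → 0 < f x → 0 < sum (map f xs)
sum-pos⁺ f {y ∷ ys} (here refl) h = <-≤-trans h (m≤m+n (f y) _)
sum-pos⁺ f {y ∷ ys} (there x∈ys) h = <-≤-trans (sum-pos⁺ f x∈ys h) (m≤n+m _ (f y))

product-pos⁺ : ∀ {A : Set} (f : A → ℕ) xs → (∀ x → 0 < f x) → 0 < product (map f xs)
product-pos⁺ f []       _ = z<s
product-pos⁺ f (x ∷ xs) H = *-pos⁺ (H x) (product-pos⁺ f xs H)

Σfin-pos⁻ : ∀ n (f : Fin n → ℕ) → 0 < Σfin n f → Σ (Fin n) (λ x → 0 < f x)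
Σfin-pos⁻ n f = sum-pos⁻ f (allFin n)

Σfin-pos⁺ : ∀ n (f : Fin n → ℕ) x → 0 < f x → 0 < Σfin n f
Σfin-pos⁺ n f x = sum-pos⁺ f (∈-allFin x)

Πfin-pos⁺ : ∀ n (f : Fin n → ℕ) → (∀ x → 0 < f x) → 0 < Πfin n f
Πfin-pos⁺ n f = product-pos⁺ f (allFin n)

Πfin-head : ∀ n (f : Fin (suc n) → ℕ) → 0 < Πfin (suc n) f → 0 < f fzero
Πfin-head n f h = proj₁ (*-pos⁻ (f fzero) _ h)

Σidx-pos⁻ : ∀ n k (F : (Fin k → Fin n) → ℕ) → 0 < Σidx n k F →
  Σ (Fin k → Fin n) (λ ι → 0 < F ι)
Σidx-pos⁻ n zero    F h = (λ ()) , h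
Σidx-pos⁻ n (suc k) F h with Σfin-pos⁻ n _ h
... | x , h′ with Σidx-pos⁻ n k (λ g → F (x ∷ᶠ g)) h′
... | g , Fxg>0 = (x ∷ᶠ g) , Fxg>0

-- A sum over index tuples is positive if its terms at the constant tuple
-- (v, …, v) are; the term is given extensionally since there is no funext.
Σidx-pos⁺ : ∀ n k (F : (Fin k → Fin n) → ℕ) v →
  (∀ ι → (∀ t → ι t ≡ v) → 0 < F ι) → 0 < Σidx n k F
Σidx-pos⁺ n zero    F v H = H (λ ()) (λ ())
Σidx-pos⁺ n (suc k) F v H =
  Σfin-pos⁺ n _ v (Σidx-pos⁺ n k (λ g → F (v ∷ᶠ g)) v
    (λ g g≡v → H (v ∷ᶠ g) (λ { fzero → refl ; (fsuc t) → g≡v t })))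

indicator-pos⁺ : ∀ {b} → T b → 0 < (if b then 1 else 0)
indicator-pos⁺ {true} _ = z<s

indicator-pos⁻ : ∀ b → 0 < (if b then 1 else 0) → T b
indicator-pos⁻ true _ = _

allEq-pos⁺ : ∀ {n q} (ι : Fin q → Fin n) v → (∀ t → ι t ≡ v) → 0 < allEq ι v
allEq-pos⁺ {q = q} ι v ι≡v = indicator-pos⁺ (all⁻ _ {allFin q}
  (All.tabulate (λ {t} _ → ≡⇒≡ᵇ (toℕ (ι t)) (toℕ v) (cong toℕ (ι≡v t)))))

allEq-pos⁻ : ∀ {n r} (ι : Fin (suc r) → Fin n) v → 0 < allEq ι v → ι fzero ≡ v
allEq-pos⁻ {r = r} ι v h =
  toℕ-injective (≡ᵇ⇒≡ _ _ (All.head (all⁺ _ (allFin (suc r)) (indicator-pos⁻ _ h))))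

diagTensor : ∀ {n} r → (Fin n → Fin n → ℕ) → Tensor n r
diagTensor {n} r M i ι = Σfin n (λ v → M i v * allEq ι v)

diag-pos⁺ : ∀ {n r} (M : Fin n → Fin n → ℕ) {u v} (ι : Fin r → Fin n) →
  0 < M u v → (∀ t → ι t ≡ v) → 0 < diagTensor r M u ι
diag-pos⁺ {n} M {u} {v} ι Muv>0 ι≡v =
  Σfin-pos⁺ n _ v (*-pos⁺ Muv>0 (allEq-pos⁺ ι v ι≡v))

diag-pos⁻ : ∀ {n r} (M : Fin n → Fin n → ℕ) {u} (ι : Fin (suc r) → Fin n) →
  0 < diagTensor (suc r) M u ι → Σ (Fin n) (λ v → 0 < M u v × ι fzero ≡ v)
diag-pos⁻ {n} M {u} ι h with Σfin-pos⁻ n _ h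
... | v , h′ with *-pos⁻ (M u v) (allEq ι v) h′
... | Muv>0 , eq>0 = v , Muv>0 , allEq-pos⁻ ι v eq>0

-- The digraph of a nonnegative matrix (a record, so that the endpoints of
-- an arc can be inferred from its type), and walks of a given length.
record Arc {n} (M : Fin n → Fin n → ℕ) (u v : Fin n) : Set where
  constructor mkArc
  field positive : 0 < M u v

infixr 5 _∷_

data Walk {V : Set} (E : V → V → Set) : ℕ → V → V → Set where
  []  : ∀ {u} → Walk E 0 u u
  _∷_ : ∀ {L u v w} → E u v → Walk E L v w → Walk E (suc L) u w

module _ {V : Set} {E : V → V → Set} where

  infixr 5 _++ʷ_
  infixl 5 _∷ʳ_

  _∷ʳ_ : ∀ {L u v w} → Walk E L u v → E v w → Walk E (suc L) u w
  []       ∷ʳ e = e ∷ []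
  (e′ ∷ w) ∷ʳ e = e′ ∷ (w ∷ʳ e)

  _++ʷ_ : ∀ {L L′ u v w} → Walk E L u v → Walk E L′ v w → Walk E (L + L′) u w
  []      ++ʷ w′ = w′
  (e ∷ w) ++ʷ w′ = e ∷ (w ++ʷ w′)

  repeat : ∀ {L u} k → Walk E L u u → Walk E (k * L) u u
  repeat zero    _ = []
  repeat (suc k) w = w ++ʷ repeat k w

module DiagonalTensor {n r : ℕ} (M : Fin n → Fin n → ℕ) where

  D : Tensor n (suc r)
  D = diagTensor (suc r) M

  base : ∀ {u w} → 0 < Mj D u w ⇔ Arc M u w
  base {u} {w} =
    mk⇔ elim (λ (mkArc Muw>0) → diag-pos⁺ {r = suc r} M (λ _ → w) Muw>0 (λ _ → refl))
    where
    elim : 0 < Mj D u w → Arc M u w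
    elim h with diag-pos⁻ {r = r} M (λ _ → w) h
    ... | v , Muv>0 , w≡v = subst (Arc M u) (sym w≡v) (mkArc Muv>0)

  step : ∀ {q} (B : Tensor n q) {u w} →
    0 < Mj (D ⊙ B) u w ⇔ Σ (Fin n) (λ v → Arc M u v × 0 < Mj B v w)
  step B {u} {w} = mk⇔ elim intro
    where
    column : (Fin (suc r) → Fin n) → Fin (suc r) → ℕ
    column ι t = B (ι t) (λ _ → w)

    elim : 0 < Mj (D ⊙ B) u w → Σ (Fin n) (λ v → Arc M u v × 0 < Mj B v w)
    elim h with Σidx-pos⁻ n (suc r) _ h
    ... | ι , h′ with *-pos⁻ (D u ι) (Πfin (suc r) (column ι)) h′
    ... | Duι>0 , Π>0 with diag-pos⁻ {r = r} M ι Duι>0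
    ... | v , Muv>0 , ι₀≡v =
      v , mkArc Muv>0 , subst (λ x → 0 < Mj B x w) ι₀≡v (Πfin-head r (column ι) Π>0)

    intro : Σ (Fin n) (λ v → Arc M u v × 0 < Mj B v w) → 0 < Mj (D ⊙ B) u w
    intro (v , mkArc Muv>0 , Bvw>0) = Σidx-pos⁺ n (suc r) _ v (λ ι ι≡v →
      *-pos⁺ (diag-pos⁺ {r = suc r} M ι Muv>0 ι≡v)
        (Πfin-pos⁺ (suc r) (column ι)
          (λ t → subst (λ x → 0 < Mj B x w) (sym (ι≡v t)) Bvw>0)))

  power-walk : ∀ k {u w} → 0 < Mj (pow D k) u w ⇔ Walk (Arc M) (suc k) u w
  power-walk zero    = mk⇔ (λ h → to base h ∷ []) (λ { (e ∷ []) → from base e })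
  power-walk (suc k) = mk⇔
    (λ h → let v , e , h′ = to (step (pow D k)) h in e ∷ to (power-walk k) h′)
    (λ { (e ∷ w) → from (step (pow D k)) (_ , e , from (power-walk k) w) })

  walks-extend : ∀ {L j} → (∀ u → Σ (Fin n) (Arc M u)) → (∀ u → Walk (Arc M) L u j) →
    ∀ d u → Walk (Arc M) (d + L) u j
  walks-extend out reach zero    u = reach u
  walks-extend out reach (suc d) u = proj₂ (out u) ∷ walks-extend out reach d (proj₁ (out u))

  primitive-degree : ∀ {j} k → (∀ u → Σ (Fin n) (Arc M u)) →
    (∀ u → Walk (Arc M) (suc k) u j) → (w : Fin n) → ¬ Walk (Arc M) k w j →
    IsPrimitiveDegree D j (suc k)
  primitive-degree {j} k out reach w unreachable =
    s≤s z≤n , (λ u → from (power-walk k) (reach u)) , earlier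
    where
    earlier : (k′ : ℕ) → 1 ≤ k′ → k′ < suc k → ¬ ColPos D j k′
    earlier (suc i) _ (s≤s i<k) colPos = unreachable
      (subst (λ L → Walk (Arc M) L w j) (m∸n+n≡m i<k)
        (walks-extend out (λ u → to (power-walk i) (colPos u)) (k ∸ suc i) w))

-- Frobenius for two consecutive integers: s² - s - 1 is not of the form
-- a·s + b·(s+1).
frobenius : ∀ s a b → a * s + b * suc s + suc s ≢ s * s
frobenius s a b eq = impossible (s ≤? q)
  where
  q : ℕ
  q = a + suc b

  regroup : ∀ a b s → a * s + b * suc s + suc s ≡ (a + suc b) * s + suc b
  regroup = solve-∀

  eq′ : q * s + suc b ≡ s * s
  eq′ = trans (sym (regroup a b s)) eq

  open ≤-Reasoning

  impossible : Dec (s ≤ q) → ⊥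
  impossible (yes s≤q) = <-irrefl (sym eq′) (begin-strict
    s * s          ≤⟨ *-monoˡ-≤ s s≤q ⟩
    q * s          <⟨ m<m+n (q * s) z<s ⟩
    q * s + suc b  ∎)
  impossible (no s≰q) = <-irrefl eq′ (begin-strict
    q * s + suc b  <⟨ +-monoʳ-< (q * s) (≤-<-trans (m≤n+m (suc b) a) q<s) ⟩
    q * s + s      ≡⟨ +-comm (q * s) s ⟩
    suc q * s      ≤⟨ *-monoˡ-≤ s q<s ⟩
    s * s          ∎)
    where
    q<s : q < s
    q<s = ≰⇒> s≰q

data M₁Arc (n : ℕ) : ℕ → ℕ → Set where
  0→n-2 : M₁Arc n 0 (n ∸ 2)
  0→n-1 : M₁Arc n 0 (n ∸ 1)
  down  : ∀ y → M₁Arc n (suc y) y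

M₁-arc⇔ : ∀ n {u v : Fin n} → Arc (M₁ n) u v ⇔ M₁Arc n (toℕ u) (toℕ v)
M₁-arc⇔ n = mk⇔ (λ (mkArc h) → sound _ _ (indicator-pos⁻ _ h))
                (λ a → mkArc (indicator-pos⁺ (complete a)))
  where
  isArc : ℕ → ℕ → Bool
  isArc x y = ((x ≡ᵇ 0) ∧ ((y ≡ᵇ n ∸ 2) ∨ (y ≡ᵇ n ∸ 1))) ∨ (x ≡ᵇ suc y)

  sound : ∀ x y → T (isArc x y) → M₁Arc n x y
  sound x y t with to (T-∨ {(x ≡ᵇ 0) ∧ ((y ≡ᵇ n ∸ 2) ∨ (y ≡ᵇ n ∸ 1))}) t
  ... | inj₂ x≡1+y = subst (λ z → M₁Arc n z y) (sym (≡ᵇ⇒≡ x (suc y) x≡1+y)) (down y)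
  ... | inj₁ t′ with to (T-∧ {x ≡ᵇ 0}) t′
  ... | x≡0 , t″ with ≡ᵇ⇒≡ x 0 x≡0 | to (T-∨ {y ≡ᵇ n ∸ 2}) t″
  ... | refl | inj₁ y≡n-2 = subst (M₁Arc n 0) (sym (≡ᵇ⇒≡ y _ y≡n-2)) 0→n-2
  ... | refl | inj₂ y≡n-1 = subst (M₁Arc n 0) (sym (≡ᵇ⇒≡ y _ y≡n-1)) 0→n-1

  complete : ∀ {x y} → M₁Arc n x y → T (isArc x y)
  complete {y = y} 0→n-2 = from (T-∨ {(y ≡ᵇ n ∸ 2) ∨ (y ≡ᵇ n ∸ 1)})
    (inj₁ (from (T-∨ {y ≡ᵇ n ∸ 2}) (inj₁ (≡⇒≡ᵇ y y refl))))
  complete {y = y} 0→n-1 = from (T-∨ {(y ≡ᵇ n ∸ 2) ∨ (y ≡ᵇ n ∸ 1)})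
    (inj₁ (from (T-∨ {y ≡ᵇ n ∸ 2}) (inj₂ (≡⇒≡ᵇ y y refl))))
  complete (down y) = ≡⇒≡ᵇ y y refl

module M₁Digraph (p : ℕ) (j : Fin (suc (suc p))) (j≡p : toℕ j ≡ p) where

  V : Set
  V = Fin (suc (suc p))

  E : V → V → Set
  E = Arc (M₁ (suc (suc p)))

  arc : ∀ {u v : V} → M₁Arc (suc (suc p)) (toℕ u) (toℕ v) → E u v
  arc = from (M₁-arc⇔ (suc (suc p)))

  top : V
  top = fromℕ (suc p)

  0→j : E fzero j
  0→j = arc (subst (M₁Arc _ 0) (sym j≡p) 0→n-2)

  0→top : E fzero top
  0→top = arc (subst (M₁Arc _ 0) (sym (toℕ-fromℕ (suc p))) 0→n-1)

  down-to-j : ∀ (u : V) → toℕ u ≡ suc p → E u j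
  down-to-j u u≡1+p = arc (subst₂ (M₁Arc _) (sym u≡1+p) (sym j≡p) (down p))

  top→j : E top j
  top→j = down-to-j top (toℕ-fromℕ (suc p))

  down-arc : (y : Fin (suc p)) → E (fsuc y) (inject₁ y)
  down-arc y = arc (subst (M₁Arc _ (suc (toℕ y))) (sym (toℕ-inject₁ y)) (down (toℕ y)))

  no-sink : (u : V) → Σ V (E u)
  no-sink fzero    = j , 0→j
  no-sink (fsuc y) = inject₁ y , down-arc y

  CycleSum : ℕ → Set
  CycleSum c = Σ ℕ λ a → Σ ℕ λ b → c ≡ a * suc p + b * suc (suc p)

  cycleSum-+ : ∀ {c c′} → CycleSum c → CycleSum c′ → CycleSum (c + c′)
  cycleSum-+ (a , b , refl) (a′ , b′ , refl) = a + a′ , b + b′ , regroup a b a′ b′ (suc p)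
    where
    regroup : ∀ a b a′ b′ s → a * s + b * suc s + (a′ * s + b′ * suc s)
                            ≡ (a + a′) * s + (b + b′) * suc s
    regroup = solve-∀

  arc-potential : ∀ {x y} → M₁Arc (suc (suc p)) x y →
    Σ ℕ λ c → CycleSum c × suc y ≡ x + c
  arc-potential 0→n-2    = suc p , (1 , 0 , sym (trans (+-identityʳ _) (+-identityʳ _))) , refl
  arc-potential 0→n-1    = suc (suc p) , (0 , 1 , sym (+-identityʳ _)) , refl
  arc-potential (down y) = 0 , (0 , 0 , refl) , sym (+-identityʳ (suc y))

  walk-potential : ∀ {L u v} → Walk E L u v → Σ ℕ λ c → CycleSum c × L + toℕ v ≡ toℕ u + c
  walk-potential {u = u} [] = 0 , (0 , 0 , refl) , sym (+-identityʳ (toℕ u))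
  walk-potential {suc L} {u} {w} (_∷_ {v = v} e walk)
    with arc-potential (to (M₁-arc⇔ _) e) | walk-potential walk
  ... | c₁ , cs₁ , arc-eq | c₂ , cs₂ , walk-eq = c₁ + c₂ , cycleSum-+ cs₁ cs₂ , (begin
    suc (L + toℕ w)        ≡⟨ cong suc walk-eq ⟩
    suc (toℕ v) + c₂       ≡⟨ cong (_+ c₂) arc-eq ⟩
    toℕ u + c₁ + c₂        ≡⟨ +-assoc (toℕ u) c₁ c₂ ⟩
    toℕ u + (c₁ + c₂)      ∎)
    where open ≡-Reasoning

  no-walk-from-top : ¬ Walk E (p * suc p) top j
  no-walk-from-top walk with walk-potential walk
  ... | c , (a , b , refl) , eq = frobenius (suc p) a b (begin
    c + suc (suc p)      ≡⟨ +-suc c (suc p) ⟩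
    suc (c + suc p)      ≡⟨ cong suc (+-comm c (suc p)) ⟩
    suc (suc p + c)      ≡⟨ cong suc (sym eq′) ⟩
    suc (p * suc p + p)  ≡⟨ cong suc (+-comm (p * suc p) p) ⟩
    suc p * suc p        ∎)
    where
    open ≡-Reasoning
    eq′ : p * suc p + p ≡ suc p + c
    eq′ = subst₂ (λ x y → p * suc p + x ≡ y + c) j≡p (toℕ-fromℕ (suc p)) eq

  descend : ∀ d (u : V) → toℕ u ≡ d → Walk E d u fzero
  descend zero    fzero    _  = []
  descend (suc d) (fsuc y) eq =
    down-arc y ∷ descend d (inject₁ y) (trans (toℕ-inject₁ y) (suc-injective eq))

  cycleA : Walk E (suc p) j j
  cycleA = descend p j j≡p ∷ʳ 0→j

  cycleB : Walk E (suc (suc p)) j j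
  cycleB = descend p j j≡p ∷ʳ 0→top ∷ʳ top→j

  cycles : ∀ a b → Walk E (a * suc p + b * suc (suc p)) j j
  cycles a b = repeat a cycleA ++ʷ repeat b cycleB

  -- The
  -- predecessors 0 and top of j take an arc into j and p times cycleA; a
  -- vertex of label x+1 ≤ p descends to 0, passes through top and then
  -- uses x copies of cycleA and p-1-x copies of cycleB.
  reach : (u : V) → Walk E (suc (p * suc p)) u j
  reach fzero    = 0→j ∷ repeat p cycleA
  reach (fsuc y) with m≤n⇒m<n∨m≡n (s≤s⁻¹ (toℕ<n y))
  ... | inj₂ y≡p = down-to-j (fsuc y) (cong suc y≡p) ∷ repeat p cycleA
  ... | inj₁ y<p = subst (λ L → Walk E L (fsuc y) j) (middle-length (toℕ y) y<p)
      ((descend (suc (toℕ y)) (fsuc y) refl ∷ʳ 0→top ∷ʳ top→j)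
        ++ʷ cycles (toℕ y) (p ∸ suc (toℕ y)))
    where
    -- (x+3) + x(p+1) + (p-1-x)(p+2) = p(p+1) + 1, checked after writing p = x+1+d.
    middle-length : ∀ x → x < p →
      suc (suc (suc x)) + (x * suc p + (p ∸ suc x) * suc (suc p)) ≡ suc (p * suc p)
    middle-length x x<p =
      subst (λ q → suc (suc (suc x)) + (x * suc q + d * suc (suc q)) ≡ suc (q * suc q))
        (m+[n∸m]≡n x<p) (identity x d)
      where
      d : ℕ
      d = p ∸ suc x

      identity : ∀ x d →
        suc (suc (suc x)) + (x * suc (suc x + d) + d * suc (suc (suc x + d)))
          ≡ suc ((suc x + d) * suc (suc x + d))
      identity = solve-∀

primitive-degree-formula : ∀ p →
  suc (suc p) * suc (suc p) + 3 ∸ 3 * suc (suc p) ≡ suc (p * suc p)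
primitive-degree-formula p = trans (cong (_∸ 3 * suc (suc p)) (expand p))
  (m+n∸n≡m (suc (p * suc p)) (3 * suc (suc p)))
  where
  expand : ∀ p → suc (suc p) * suc (suc p) + 3 ≡ suc (p * suc p) + 3 * suc (suc p)
  expand = solve-∀

proposition4p5 : (n m : ℕ) → 2 ≤ n → 2 ≤ m → (j : Fin n) → toℕ j ≡ n ∸ 2 →
    IsPrimitiveDegree (𝔸₀ n (m ∸ 1)) j (n * n + 3 ∸ 3 * n)
proposition4p5 (suc (suc p)) (suc (suc r)) (s≤s (s≤s z≤n)) (s≤s (s≤s z≤n)) j j≡p =
  subst (IsPrimitiveDegree (𝔸₀ (suc (suc p)) (suc r)) j) (sym (primitive-degree-formula p))
    (primitive-degree (p * suc p) no-sink reach top no-walk-from-top)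
  where
  open M₁Digraph p j j≡p
  open DiagonalTensor {r = r} (M₁ (suc (suc p)))
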